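{- If $T$ is an out-quadrangular tournament with $\delta^{+}(T)\geq 2$, then $\delta^{+}(T)\geq 4$.
   Context: A tournament $T$ is a loopless digraph in which for each pair of distinct vertices exactly one of $(u,v)$, $(v,u)$ is an arc. $O(v)$ is the set of vertices that $v$ beats. A digraph is out-quadrangular if $|O(u)\cap O(v)|\neq 1$ for all distinct vertices $u,v$. $\delta^{+}(T)$ is the minimum out-degree of $T$. -}

module Defs where

open import Data.Nat using (ℕ; _≤_)
open import Data.Bool using (Bool; true; false)
open import Data.Fin using (Fin)
open import Data.Fin.Subset using (Subset; ∣_∣; _∩_)
open import Data.Vec using (tabulate)
open import Data.Product using (_×_)
open import Data.Sum using (_⊎_)
open import Relation.Binary.PropositionalEquality using (_≡_; _≢_)
open import Relation.Nullary using (¬_)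

-- A digraph on the vertex set Fin n, given by its (decidable) arc relation:
-- A u v ≡ true  iff  (u,v) is an arc, i.e. u beats v.
Digraph : ℕ → Set
Digraph n = Fin n → Fin n → Bool

record IsTournament {n : ℕ} (T : Digraph n) : Set where
  field
    loopless  : ∀ v → T v v ≡ false
    oneArc    : ∀ u v → u ≢ v → (T u v ≡ true) ⊎ (T v u ≡ true)
    notBoth   : ∀ u v → ¬ ((T u v ≡ true) × (T v u ≡ true))

O : {n : ℕ} → Digraph n → Fin n → Subset n
O T v = tabulate (λ w → T v w)

outdeg : {n : ℕ} → Digraph n → Fin n → ℕ
outdeg T v = ∣ O T v ∣

OutQuadrangular : {n : ℕ} → Digraph n → Set
OutQuadrangular T = ∀ u v → u ≢ v → ¬ (∣ O T u ∩ O T v ∣ ≡ 1)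

MinOutDegAtLeast : {n : ℕ} → Digraph n → ℕ → Set
MinOutDegAtLeast T k = ∀ v → k ≤ outdeg T v

-- Let x ∈ O(v). Then O(v) ∩ O(x) is the set of out-neighbours of x inside the
-- subtournament on O(v), so out-quadrangularity says that no vertex of that
-- subtournament has out-degree exactly 1. But every tournament on two or three
-- vertices has such a vertex: with two vertices the tail of the arc, with three
-- the middle vertex x of a directed path z → x → y (which exists in a 3-cycle
-- and in a transitive triple), since x beats neither itself nor z. Hence no
-- out-degree is 2 or 3.
module Submission where

open import Defs
open import Data.Nat using (ℕ; suc; _≤_; _<_; _+_; s≤s; s≤s⁻¹; z≤n)
open import Data.Nat.Properties
  using (≤-antisym; ≤-trans; ≤-<-trans; ≤-reflexive; suc-injective; ≤∧≢⇒<; module ≤-Reasoning)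
open import Data.Fin using (Fin; zero; suc)
open import Data.Fin.Subset using (Subset; inside; outside; _∈_; _∉_; _⊆_; _∩_; _-_; ⁅_⁆; ∣_∣; Nonempty)
open import Data.Fin.Subset.Properties
  using (p─⊥≡p; ∣⊥∣≡0; Empty-unique; nonempty?; x∈p⇒∣p-x∣<∣p∣; p⊆q⇒∣p∣≤∣q∣; p─q⊆p; x∈p∧x≢y⇒x∈p-y; x∈p∩q⁺; x∈p∩q⁻)
open import Data.Vec using (_∷_; here; there)
open import Data.Vec.Properties using (lookup∘tabulate; []=⇒lookup; lookup⇒[]=)
open import Data.Product using (∃-syntax; _×_; _,_)
open import Data.Bool using (true)
open import Data.Sum using (inj₁; inj₂)
open import Relation.Binary.PropositionalEquality using (_≡_; _≢_; refl; sym; trans; cong; ≢-sym)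
open import Function using (_∘_)
open import Relation.Nullary using (¬_; yes; no; contradiction)

private
  variable
    n k : ℕ
    p S : Subset n
    v w x y z : Fin n

x∉p-x : x ∉ p - x
x∉p-x {x = zero}  {p = s ∷ p} ()
x∉p-x {x = suc x} {p = s ∷ p} (there x∈p-x) = x∉p-x x∈p-x

x∈p-y⁻ : x ∈ p - y → x ∈ p × x ≢ y
x∈p-y⁻ {p = p} {y = y} x∈p-y = p─q⊆p p ⁅ y ⁆ x∈p-y , λ { refl → x∉p-x x∈p-y }

x∈p⇒∣p∣≡1+∣p-x∣ : x ∈ p → ∣ p ∣ ≡ suc ∣ p - x ∣
x∈p⇒∣p∣≡1+∣p-x∣ {p = inside ∷ p} here = cong (λ q → suc ∣ q ∣) (sym (p─⊥≡p p))
x∈p⇒∣p∣≡1+∣p-x∣ {p = inside ∷ p} (there x∈p) = cong suc (x∈p⇒∣p∣≡1+∣p-x∣ x∈p)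
x∈p⇒∣p∣≡1+∣p-x∣ {p = outside ∷ p} (there x∈p) = x∈p⇒∣p∣≡1+∣p-x∣ x∈p

∣p∣≢0⇒Nonempty : ∀ {n} {p : Subset n} → ∣ p ∣ ≢ 0 → Nonempty p
∣p∣≢0⇒Nonempty {n = n} {p = p} ∣p∣≢0 with nonempty? p
... | yes ne = ne
... | no ¬ne = contradiction (trans (cong ∣_∣ (Empty-unique ¬ne)) (∣⊥∣≡0 n)) ∣p∣≢0

∣p∣≡1+k⇒∃[x∈p]∣p-x∣≡k : ∣ p ∣ ≡ suc k → ∃[ x ] x ∈ p × ∣ p - x ∣ ≡ k
∣p∣≡1+k⇒∃[x∈p]∣p-x∣≡k ∣p∣≡1+k with ∣p∣≢0⇒Nonempty (λ ∣p∣≡0 → contradiction (trans (sym ∣p∣≡1+k) ∣p∣≡0) λ ())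
... | x , x∈p = x , x∈p , suc-injective (trans (sym (x∈p⇒∣p∣≡1+∣p-x∣ x∈p)) ∣p∣≡1+k)

∣p∣≡2⇒∃distinctPair : ∣ p ∣ ≡ 2 → ∃[ a ] ∃[ b ] a ∈ p × b ∈ p × a ≢ b
∣p∣≡2⇒∃distinctPair ∣p∣≡2 with ∣p∣≡1+k⇒∃[x∈p]∣p-x∣≡k ∣p∣≡2
... | a , a∈p , ∣p-a∣≡1 with ∣p∣≡1+k⇒∃[x∈p]∣p-x∣≡k ∣p-a∣≡1
... | b , b∈p-a , _ with x∈p-y⁻ b∈p-a
... | b∈p , b≢a = a , b , a∈p , b∈p , ≢-sym b≢a

∣p∣≡3⇒∃distinctTriple : ∣ p ∣ ≡ 3 →
  ∃[ a ] ∃[ b ] ∃[ c ] a ∈ p × b ∈ p × c ∈ p × a ≢ b × a ≢ c × b ≢ c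
∣p∣≡3⇒∃distinctTriple ∣p∣≡3 with ∣p∣≡1+k⇒∃[x∈p]∣p-x∣≡k ∣p∣≡3
... | a , a∈p , ∣p-a∣≡2 with ∣p∣≡2⇒∃distinctPair ∣p-a∣≡2
... | b , c , b∈p-a , c∈p-a , b≢c with x∈p-y⁻ b∈p-a | x∈p-y⁻ c∈p-a
... | b∈p , b≢a | c∈p , c≢a = a , b , c , a∈p , b∈p , c∈p , ≢-sym b≢a , ≢-sym c≢a , b≢c

x∈p∧∣p∣≤1⇒∣p∣≡1 : x ∈ p → ∣ p ∣ ≤ 1 → ∣ p ∣ ≡ 1
x∈p∧∣p∣≤1⇒∣p∣≡1 x∈p ∣p∣≤1 = ≤-antisym ∣p∣≤1 (≤-<-trans z≤n (x∈p⇒∣p-x∣<∣p∣ x∈p))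

module _ (T : Digraph n) where

  ∈O⁺ : T v w ≡ true → w ∈ O T v
  ∈O⁺ {v = v} {w = w} Tvw = lookup⇒[]= w (O T v) (trans (lookup∘tabulate (T v) w) Tvw)

  ∈O⁻ : w ∈ O T v → T v w ≡ true
  ∈O⁻ {w = w} {v = v} w∈Ov = trans (sym (lookup∘tabulate (T v) w)) ([]=⇒lookup w∈Ov)

record PathOfLength2In {n : ℕ} (T : Digraph n) (P : Fin n → Set) : Set where
  constructor path
  field
    {source middle target} : Fin n
    source∈P : P source
    middle∈P : P middle
    target∈P : P target
    source⟶middle : T source middle ≡ true
    middle⟶target : T middle target ≡ true

module _ {T : Digraph n} (isT : IsTournament T) where
  open IsTournament isT

  arc⇒≢ : T x y ≡ true → x ≢ y
  arc⇒≢ {x} Txx refl = contradiction (trans (sym Txx) (loopless x)) λ ()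

  S∩Ox⊆S-x : S ∩ O T x ⊆ S - x
  S∩Ox⊆S-x {S = S} {x = x} w∈ with x∈p∩q⁻ S (O T x) w∈
  ... | w∈S , w∈Ox = x∈p∧x≢y⇒x∈p-y w∈S (≢-sym (arc⇒≢ (∈O⁻ T w∈Ox)))

  S∩Ox⊆S-x-z : T z x ≡ true → S ∩ O T x ⊆ S - x - z
  S∩Ox⊆S-x-z {z = z} {x = x} {S = S} Tzx w∈ with x∈p∩q⁻ S (O T x) w∈
  ... | _ , w∈Ox = x∈p∧x≢y⇒x∈p-y (S∩Ox⊆S-x w∈) λ { refl → notBoth x z (∈O⁻ T w∈Ox , Tzx) }

  arc⇒pathOfLength2 : {P : Fin n → Set} {a b c : Fin n} → P a → P b → P c →
    a ≢ c → b ≢ c → T a b ≡ true → PathOfLength2In T P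
  arc⇒pathOfLength2 {a = a} {b} {c} Pa Pb Pc a≢c b≢c Tab with oneArc a c a≢c | oneArc b c b≢c
  ... | inj₂ Tca | _        = path Pc Pa Pb Tca Tab
  ... | inj₁ Tac | inj₁ Tbc = path Pa Pb Pc Tab Tbc
  ... | inj₁ Tac | inj₂ Tcb = path Pa Pc Pb Tac Tcb

  ∃pathOfLength2 : {P : Fin n → Set} {a b c : Fin n} → P a → P b → P c →
    a ≢ b → a ≢ c → b ≢ c → PathOfLength2In T P
  ∃pathOfLength2 {a = a} {b} Pa Pb Pc a≢b a≢c b≢c with oneArc a b a≢b
  ... | inj₁ Tab = arc⇒pathOfLength2 Pa Pb Pc a≢c b≢c Tab
  ... | inj₂ Tba = arc⇒pathOfLength2 Pb Pa Pc b≢c a≢c Tba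

  ∣S∩Ox∣<∣S∣ : x ∈ S → ∣ S ∩ O T x ∣ < ∣ S ∣
  ∣S∩Ox∣<∣S∣ {x = x} {S = S} x∈S = ≤-<-trans (p⊆q⇒∣p∣≤∣q∣ (S∩Ox⊆S-x {S = S} {x = x})) (x∈p⇒∣p-x∣<∣p∣ x∈S)

  2+∣S∩Ox∣≤∣S∣ : x ∈ S → z ∈ S → T z x ≡ true → 2 + ∣ S ∩ O T x ∣ ≤ ∣ S ∣
  2+∣S∩Ox∣≤∣S∣ {x = x} {S = S} {z = z} x∈S z∈S Tzx = begin-strict
    suc ∣ S ∩ O T x ∣ ≤⟨ s≤s (p⊆q⇒∣p∣≤∣q∣ (S∩Ox⊆S-x-z {S = S} Tzx)) ⟩
    suc ∣ S - x - z ∣ ≤⟨ x∈p⇒∣p-x∣<∣p∣ (x∈p∧x≢y⇒x∈p-y z∈S (arc⇒≢ Tzx)) ⟩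
    ∣ S - x ∣         <⟨ x∈p⇒∣p-x∣<∣p∣ x∈S ⟩
    ∣ S ∣             ∎
    where open ≤-Reasoning

  ∣S∣≡2⇒∣S∩Ox∣≡1 : ∣ S ∣ ≡ 2 → x ∈ S → y ∈ S → T x y ≡ true → ∣ S ∩ O T x ∣ ≡ 1
  ∣S∣≡2⇒∣S∩Ox∣≡1 ∣S∣≡2 x∈S y∈S Txy = x∈p∧∣p∣≤1⇒∣p∣≡1 (x∈p∩q⁺ (y∈S , ∈O⁺ T Txy))
    (s≤s⁻¹ (≤-trans (∣S∩Ox∣<∣S∣ x∈S) (≤-reflexive ∣S∣≡2)))

  ∣S∣≡3⇒∣S∩Omiddle∣≡1 : ∣ S ∣ ≡ 3 → (π : PathOfLength2In T (_∈ S)) →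
    ∣ S ∩ O T (PathOfLength2In.middle π) ∣ ≡ 1
  ∣S∣≡3⇒∣S∩Omiddle∣≡1 ∣S∣≡3 (path source∈S middle∈S target∈S Tsm Tmt) =
    x∈p∧∣p∣≤1⇒∣p∣≡1 (x∈p∩q⁺ (target∈S , ∈O⁺ T Tmt))
      (s≤s⁻¹ (s≤s⁻¹ (≤-trans (2+∣S∩Ox∣≤∣S∣ middle∈S source∈S Tsm) (≤-reflexive ∣S∣≡3))))

  ∣S∣≡2⇒∃[x∈S]∣S∩Ox∣≡1 : ∣ S ∣ ≡ 2 → ∃[ x ] x ∈ S × ∣ S ∩ O T x ∣ ≡ 1
  ∣S∣≡2⇒∃[x∈S]∣S∩Ox∣≡1 ∣S∣≡2 with ∣p∣≡2⇒∃distinctPair ∣S∣≡2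
  ... | a , b , a∈S , b∈S , a≢b with oneArc a b a≢b
  ... | inj₁ Tab = a , a∈S , ∣S∣≡2⇒∣S∩Ox∣≡1 ∣S∣≡2 a∈S b∈S Tab
  ... | inj₂ Tba = b , b∈S , ∣S∣≡2⇒∣S∩Ox∣≡1 ∣S∣≡2 b∈S a∈S Tba

  ∣S∣≡3⇒∃[x∈S]∣S∩Ox∣≡1 : ∣ S ∣ ≡ 3 → ∃[ x ] x ∈ S × ∣ S ∩ O T x ∣ ≡ 1
  ∣S∣≡3⇒∃[x∈S]∣S∩Ox∣≡1 ∣S∣≡3 with ∣p∣≡3⇒∃distinctTriple ∣S∣≡3
  ... | a , b , c , a∈S , b∈S , c∈S , a≢b , a≢c , b≢c =
    middle , middle∈P , ∣S∣≡3⇒∣S∩Omiddle∣≡1 ∣S∣≡3 π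
    where
    π = ∃pathOfLength2 a∈S b∈S c∈S a≢b a≢c b≢c
    open PathOfLength2In π

  module _ (oq : OutQuadrangular T) where

    ¬∃[x∈Ov]∣Ov∩Ox∣≡1 : ¬ (∃[ x ] x ∈ O T v × ∣ O T v ∩ O T x ∣ ≡ 1)
    ¬∃[x∈Ov]∣Ov∩Ox∣≡1 {v = v} (x , x∈Ov , ∣Ov∩Ox∣≡1) = oq v x (arc⇒≢ (∈O⁻ T x∈Ov)) ∣Ov∩Ox∣≡1

    outdeg≢2 : outdeg T v ≢ 2
    outdeg≢2 = ¬∃[x∈Ov]∣Ov∩Ox∣≡1 ∘ ∣S∣≡2⇒∃[x∈S]∣S∩Ox∣≡1

    outdeg≢3 : outdeg T v ≢ 3
    outdeg≢3 = ¬∃[x∈Ov]∣Ov∩Ox∣≡1 ∘ ∣S∣≡3⇒∃[x∈S]∣S∩Ox∣≡1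

corollary11 : (n : ℕ) (T : Digraph n) → IsTournament T → OutQuadrangular T →
    MinOutDegAtLeast T 2 → MinOutDegAtLeast T 4
corollary11 n T isT oq δ⁺≥2 v =
  ≤∧≢⇒< (≤∧≢⇒< (δ⁺≥2 v) (≢-sym (outdeg≢2 isT oq))) (≢-sym (outdeg≢3 isT oq))
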